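{- For $n\geq 1$, $|\hat{\mathcal{B}}_n(3231)|=2^{n-1}-n+1$.
   Context: An endofunction of size $n$ is a word $x=x_1\cdots x_n$ with entries in $\{1,\dots,n\}$; it is a Cayley permutation if it contains every integer between $1$ and $\max(x)$. Let $\mathrm{Ascbot}(x)=\{1\}\cup\{i:1\leq i\leq n-1,\ x_i<x_{i+1}\}$ and $\mathrm{Nub}(x)$ the set of indices $i$ such that $x_i$ is the leftmost occurrence of its value. A revised ascent sequence of length $n$ is a Cayley permutation $x$ of length $n$ with $\mathrm{Ascbot}(x)=\mathrm{Nub}(x)$. For Cayley permutations $x$ and $\sigma=\sigma_1\cdots\sigma_k$, $x$ contains $\sigma$ if there are indices $i_1<\cdots<i_k$ such that for all $s,t$: $x_{i_s}<x_{i_t}\iff\sigma_s<\sigma_t$ and $x_{i_s}=x_{i_t}\iff\sigma_s=\sigma_t$; otherwise $x$ avoids $\sigma$. $\hat{\mathcal{B}}_n(\sigma)$ is the set of revised ascent sequences of length $n$ avoiding $\sigma$. -}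

module Defs where

open import Data.Bool.ListAction using (all; any)

open import Data.Nat using (ℕ; zero; suc; _<ᵇ_; _≡ᵇ_; _⊔_; _∸_; _^_; _+_)
open import Data.Bool using (Bool; true; false; _∧_; _∨_; not; T)
open import Data.List using (List; []; _∷_; length; map; _++_; upTo; foldr; zipWith; drop)
open import Data.Product using (Σ; _,_; _×_; proj₁; proj₂)

-- Words are lists of natural numbers (entries are the actual values, 1-based).
Word : Set
Word = List ℕ

isEndo : ℕ → Word → Bool
isEndo n x = (length x ≡ᵇ n) ∧ all (λ v → (0 <ᵇ v) ∧ ((v <ᵇ n) ∨ (v ≡ᵇ n))) x

maxW : Word → ℕ
maxW = foldr _⊔_ 0

elem : ℕ → Word → Bool
elem v = any (λ w → v ≡ᵇ w)

isCayley : Word → Bool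
isCayley x = all (λ i → elem (suc i) x) (upTo (maxW x))

-- lookup with default 0 (0-based index)
at : Word → ℕ → ℕ
at [] _ = 0
at (a ∷ _) zero = a
at (_ ∷ xs) (suc i) = at xs i

take' : ℕ → Word → Word
take' zero _ = []
take' (suc k) [] = []
take' (suc k) (a ∷ xs) = a ∷ take' k xs

-- Using 1-based positions p ∈ {1,…,n}:
-- p ∈ Ascbot(x) iff p = 1 or (p ≤ n-1 and x_p < x_{p+1}).
-- With 0-based index i = p-1: i = 0 or x_i < x_{i+1} (with i+1 < n).
inAscbot : Word → ℕ → Bool
inAscbot x zero = true
inAscbot x (suc i) = ((suc (suc i)) <ᵇ suc (length x)) ∧ (at x (suc i) <ᵇ at x (suc (suc i)))

inNub : Word → ℕ → Bool
inNub x i = not (elem (at x i) (take' i x))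

_⇔ᵇ_ : Bool → Bool → Bool
true ⇔ᵇ b = b
false ⇔ᵇ b = not b

ascbotEqNub : Word → Bool
ascbotEqNub x = all (λ i → inAscbot x i ⇔ᵇ inNub x i) (upTo (length x))

isRAS : Word → Bool
isRAS x = isCayley x ∧ ascbotEqNub x

subseqs : ℕ → Word → List Word
subseqs zero _ = [] ∷ []
subseqs (suc k) [] = []
subseqs (suc k) (a ∷ xs) = map (a ∷_) (subseqs k xs) ++ subseqs (suc k) xs

orderIso : Word → Word → Bool
orderIso y σ = all (λ p → all (λ q → ((proj₁ p <ᵇ proj₁ q) ⇔ᵇ (proj₂ p <ᵇ proj₂ q)) ∧ ((proj₁ p ≡ᵇ proj₁ q) ⇔ᵇ (proj₂ p ≡ᵇ proj₂ q))) ps) ps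
  where
  ps : List (ℕ × ℕ)
  ps = zipWith _,_ y σ

contains : Word → Word → Bool
contains x σ = any (λ y → orderIso y σ) (subseqs (length σ) x)

avoids : Word → Word → Bool
avoids x σ = not (contains x σ)

inBhat : ℕ → Word → Word → Bool
inBhat n σ x = isEndo n x ∧ isRAS x ∧ avoids x σ

-- \hat{B}_n(σ) as a type (Bool-valued predicate, so proofs are irrelevant).
Bhat : ℕ → Word → Set
Bhat n σ = Σ Word (λ x → T (inBhat n σ x))

pattern3231 : Word
pattern3231 = 3 ∷ 2 ∷ 3 ∷ 1 ∷ []

{-# OPTIONS --safe #-}
-- Apart from 1ⁿ, a word of B̂ₙ(3231) starts with its maximum h ≥ 2 (a later first
-- occurrence of the maximum would be new, hence would ascend), and its
-- second letter is h or 1: any other letter is new, hence ascends, and the 1 still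
-- to come completes a 3231. Removing a duplicated head, or, for h 1 w with h ≥ 3
-- (where w contains no 1), removing the 1 and lowering the other letters by one,
-- gives a word of B̂ₙ₋₁(3231) other than 1ⁿ⁻¹; for h = 2 the word is 2 1 2ʲ 1ⁿ⁻²⁻ʲ
-- with 1 ≤ j ≤ n − 2. So the number aₙ of words other than 1ⁿ satisfies a₁ = 0 and
-- aₙ₊₁ = 2aₙ + n − 1, whence aₙ = 2ⁿ⁻¹ − n.
module Submission where

open import Defs
open import Data.Nat using (ℕ; _≤_; _+_; _∸_; _^_)
open import Data.Fin using (Fin)
open import Function.Bundles using (_↔_)

open import Data.Bool using (Bool; true; false; _∧_; _∨_; not; T)
open import Data.Bool.ListAction using (all; and)
open import Data.Bool.Properties using (T-∧; T-∨; T-≡; T-not-≡; T-irrelevant)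
open import Data.Empty using (⊥; ⊥-elim)
open import Data.Fin using (zero; suc)
open import Data.Fin.Properties using (+↔⊎; 1↔⊤)
open import Data.List using (List; []; _∷_; [_]; length; map; _++_; drop; upTo; applyUpTo; replicate)
open import Data.List.Membership.Propositional using (_∈_; _∉_; find; lose)
open import Data.List.Membership.Propositional.Properties using (∈-++⁺ˡ; ∈-++⁺ʳ; ∈-++⁻; ∈-map⁺; ∈-map⁻; ∈-upTo⁺; ∈-upTo⁻)
open import Data.List.Properties
  using (length-++; length-replicate; length-map; ++-assoc; map-applyUpTo; map-++; map-∘; map-id;
         ∷-injective; ∷-injectiveʳ; map-injective)
open import Data.List.Relation.Binary.Sublist.Propositional using (_⊆_; []; _∷_; _∷ʳ_; from∈; minimum)
open import Data.List.Relation.Binary.Sublist.Propositional.Properties using (++⁺; map⁺; All-resp-⊆)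
open import Data.List.Relation.Unary.All as All using (All; []; _∷_)
open import Data.List.Relation.Unary.All.Properties using (all⁺; all⁻; replicate⁺) renaming (map⁺ to All-map⁺)
open import Data.List.Relation.Unary.Any as Any using (here; there)
open import Data.List.Relation.Unary.Any.Properties using (any⁺; any⁻)
open import Data.Nat as ℕ using (zero; suc; pred; _<_; _⊔_; _<ᵇ_; _≡ᵇ_; s≤s; z≤n; s<s; s<s⁻¹; s≤s⁻¹)
open import Data.Nat.Properties
open import Data.Nat.Solver using (module +-*-Solver)
open import Data.List.Membership.DecPropositional _≟_ using (_∈?_)
open import Data.Product as Product using (Σ; ∃-syntax; _×_; _,_; proj₁; proj₂; uncurry)
open import Data.Sum using (_⊎_; inj₁; inj₂; [_,_]′)
open import Data.Sum.Function.Propositional using (_⊎-↔_)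
open import Data.Unit using (⊤; tt)
open import Function using (_∘_; id)
open import Function.Bundles using (_⇔_; mk⇔; Equivalence; mk↔ₛ′)
open import Function.Properties.Equivalence using () renaming (sym to ⇔-sym; trans to ⇔-trans)
open import Function.Properties.Inverse using (↔-refl; ↔-trans)
open import Function.Related.TypeIsomorphisms using (¬-cong-⇔)
open import Relation.Binary.PropositionalEquality using (_≡_; _≢_; refl; sym; trans; cong; cong₂; subst; module ≡-Reasoning)
open import Relation.Nullary using (¬_; yes; no)

open Equivalence using (to; from)

T-not : ∀ {b} → T (not b) ⇔ (¬ T b)
T-not {true}  = mk⇔ (λ ()) (λ ¬tt → ¬tt tt)
T-not {false} = mk⇔ (λ _ ()) (λ _ → tt)

T-⇔ᵇ : ∀ {a b} → T (a ⇔ᵇ b) ⇔ (T a ⇔ T b)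
T-⇔ᵇ {true}  {true}  = mk⇔ (λ _ → mk⇔ id id) (λ _ → tt)
T-⇔ᵇ {true}  {false} = mk⇔ (λ ()) (λ a⇔b → to a⇔b tt)
T-⇔ᵇ {false} {true}  = mk⇔ (λ ()) (λ a⇔b → from a⇔b tt)
T-⇔ᵇ {false} {false} = mk⇔ (λ _ → mk⇔ id id) (λ _ → tt)

T-elem : ∀ {v} xs → T (elem v xs) ⇔ v ∈ xs
T-elem {v} xs = mk⇔ (Any.map (≡ᵇ⇒≡ v _) ∘ any⁻ _ xs) (any⁺ _ ∘ Any.map (≡⇒≡ᵇ v _))

T-<ᵇ : ∀ {m n} → T (m <ᵇ n) ⇔ m < n
T-<ᵇ = mk⇔ (<ᵇ⇒< _ _) <⇒<ᵇ

T-∉ : ∀ {v} xs → T (not (elem v xs)) ⇔ v ∉ xs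
T-∉ xs = ⇔-trans T-not (¬-cong-⇔ (T-elem xs))

⇔-transport : ∀ {A A′ B B′ : Set} → A ⇔ A′ → B ⇔ B′ → A ⇔ B → A′ ⇔ B′
⇔-transport A⇔A′ B⇔B′ A⇔B = ⇔-trans (⇔-sym A⇔A′) (⇔-trans A⇔B B⇔B′)

T-⇔ᵇ-reflects : ∀ {a b} {A B : Set} → T a ⇔ A → T b ⇔ B → T (a ⇔ᵇ b) ⇔ (A ⇔ B)
T-⇔ᵇ-reflects a⇔A b⇔B = mk⇔ (⇔-transport a⇔A b⇔B ∘ to T-⇔ᵇ) (from T-⇔ᵇ ∘ ⇔-transport (⇔-sym a⇔A) (⇔-sym b⇔B))

-- Ascbot = Nub, read letter by letter after the prefix seen: a letter is an ascent
-- bottom iff it is new (position 1 lies in both sets, so a ∷ r is read after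
-- [ a ]). The last letter is compared with the junk value at [] 0 = 0, so it must
-- be a repeat, matching the fact that position n is never in Ascbot.
data NewIffAscent (seen : Word) : Word → Set where
  []  : NewIffAscent seen []
  _∷_ : ∀ {u r} → (u < at r 0 ⇔ u ∉ seen) → NewIffAscent (seen ++ [ u ]) r → NewIffAscent seen (u ∷ r)

module _ {seen : Word} {u : ℕ} {r : Word} where

  NewIffAscent-tail : NewIffAscent seen (u ∷ r) → NewIffAscent (seen ++ [ u ]) r
  NewIffAscent-tail (_ ∷ rest) = rest

  new⇒ascent : NewIffAscent seen (u ∷ r) → u ∉ seen → u < at r 0
  new⇒ascent (u⇔ ∷ _) = from u⇔

  seen⇒descent : NewIffAscent seen (u ∷ r) → u ∈ seen → at r 0 ≤ u
  seen⇒descent (u⇔ ∷ _) u∈ = ≮⇒≥ (λ u<v → to u⇔ u<v u∈)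

  new-∷ : u ∉ seen → u < at r 0 → NewIffAscent (seen ++ [ u ]) r → NewIffAscent seen (u ∷ r)
  new-∷ u∉ u<v = mk⇔ (λ _ → u∉) (λ _ → u<v) ∷_

  seen-∷ : u ∈ seen → at r 0 ≤ u → NewIffAscent (seen ++ [ u ]) r → NewIffAscent seen (u ∷ r)
  seen-∷ u∈ v≤u = mk⇔ (λ u<v → ⊥-elim (<⇒≱ u<v v≤u)) (λ u∉ → ⊥-elim (u∉ u∈)) ∷_

newIffAscentᵇ : Word → Word → Bool
newIffAscentᵇ seen []      = true
newIffAscentᵇ seen (u ∷ r) = ((u <ᵇ at r 0) ⇔ᵇ not (elem u seen)) ∧ newIffAscentᵇ (seen ++ [ u ]) r

T-newIffAscent : ∀ {seen r} → T (newIffAscentᵇ seen r) ⇔ NewIffAscent seen r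
T-newIffAscent {seen} {[]}    = mk⇔ (λ _ → []) (λ _ → tt)
T-newIffAscent {seen} {u ∷ r} = mk⇔
  (λ t → let u⇔ , rest = to (T-∧ {(u <ᵇ at r 0) ⇔ᵇ not (elem u seen)}) t
         in to head⇔ u⇔ ∷ to T-newIffAscent rest)
  (λ { (u⇔ ∷ rest) → from T-∧ (from head⇔ u⇔ , from T-newIffAscent rest) })
  where
  head⇔ : T ((u <ᵇ at r 0) ⇔ᵇ not (elem u seen)) ⇔ (u < at r 0 ⇔ u ∉ seen)
  head⇔ = T-⇔ᵇ-reflects T-<ᵇ (T-∉ seen)

ascbot⇔ᵇnubAt : Word → ℕ → Bool
ascbot⇔ᵇnubAt x i = inAscbot x i ⇔ᵇ inNub x i

at-++-length : ∀ p u r → at (p ++ u ∷ r) (length p) ≡ u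
at-++-length []      u r = refl
at-++-length (_ ∷ p) u r = at-++-length p u r

take'-++-length : ∀ p q → take' (length p) (p ++ q) ≡ p
take'-++-length []      q = refl
take'-++-length (a ∷ p) q = cong (a ∷_) (take'-++-length p q)

inAscbot-boundary : ∀ a p u r → inAscbot (a ∷ p ++ u ∷ r) (suc (length p)) ≡ (u <ᵇ at r 0)
inAscbot-boundary a []      u r = refl
inAscbot-boundary a (_ ∷ p) u r = inAscbot-boundary a p u r

inNub-boundary : ∀ a p u r → inNub (a ∷ p ++ u ∷ r) (suc (length p)) ≡ not (elem u (a ∷ p))
inNub-boundary a p u r rewrite at-++-length p u r | take'-++-length p (u ∷ r) = refl

ascbot⇔ᵇnub-boundary : ∀ a p u r → ascbot⇔ᵇnubAt (a ∷ p ++ u ∷ r) (suc (length p)) ≡ ((u <ᵇ at r 0) ⇔ᵇ not (elem u (a ∷ p)))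
ascbot⇔ᵇnub-boundary a p u r = cong₂ _⇔ᵇ_ (inAscbot-boundary a p u r) (inNub-boundary a p u r)

-- f is fixed only pointwise, so the index arithmetic needs no function extensionality.
ascbotEqNub-suffix : ∀ {x} a p r (f : ℕ → Bool) → a ∷ p ++ r ≡ x → (∀ i → f i ≡ ascbot⇔ᵇnubAt x (suc (i + length p))) →
                and (applyUpTo f (length r)) ≡ newIffAscentᵇ (a ∷ p) r
ascbotEqNub-suffix a p []      f _    _  = refl
ascbotEqNub-suffix a p (u ∷ r) f refl f≗ =
  cong₂ _∧_ (trans (f≗ 0) (ascbot⇔ᵇnub-boundary a p u r))
            (ascbotEqNub-suffix a (p ++ [ u ]) r (f ∘ suc) (cong (a ∷_) (++-assoc p [ u ] r)) f∘suc≗)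
  where
  index : ∀ i → suc (i + length p) ≡ i + length (p ++ [ u ])
  index i = begin
    suc (i + length p)     ≡⟨ sym (+-suc i (length p)) ⟩
    i + suc (length p)     ≡⟨ cong (i +_) (+-comm 1 (length p)) ⟩
    i + (length p + 1)     ≡⟨ cong (i +_) (sym (length-++ p)) ⟩
    i + length (p ++ [ u ]) ∎
    where open ≡-Reasoning
  f∘suc≗ : ∀ i → f (suc i) ≡ ascbot⇔ᵇnubAt (a ∷ p ++ u ∷ r) (suc (i + length (p ++ [ u ])))
  f∘suc≗ i = trans (f≗ (suc i)) (cong (ascbot⇔ᵇnubAt (a ∷ p ++ u ∷ r) ∘ suc) (index i))

ascbotEqNub-∷ : ∀ a r → ascbotEqNub (a ∷ r) ≡ newIffAscentᵇ [ a ] r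
ascbotEqNub-∷ a r =
  trans (cong (and ∘ (true ∷_)) (map-applyUpTo suc (ascbot⇔ᵇnubAt (a ∷ r)) (length r)))
        (ascbotEqNub-suffix a [] r (ascbot⇔ᵇnubAt (a ∷ r) ∘ suc) refl
                            (λ i → cong (ascbot⇔ᵇnubAt (a ∷ r) ∘ suc) (sym (+-identityʳ i))))

T-ascbotEqNub-∷ : ∀ {a r} → T (ascbotEqNub (a ∷ r)) ⇔ NewIffAscent [ a ] r
T-ascbotEqNub-∷ {a} {r} = mk⇔ (to T-newIffAscent ∘ subst T (ascbotEqNub-∷ a r))
                              (subst T (sym (ascbotEqNub-∷ a r)) ∘ from T-newIffAscent)

data Contains3231 (x : Word) : Set where
  occurrence : ∀ {a b c} → a ∷ b ∷ a ∷ c ∷ [] ⊆ x → c < b → b < a → Contains3231 x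

∈-subseqs⁻ : ∀ k xs {ys} → ys ∈ subseqs k xs → ys ⊆ xs × length ys ≡ k
∈-subseqs⁻ zero    xs       (here refl) = minimum xs , refl
∈-subseqs⁻ (suc k) (x ∷ xs) ys∈ with ∈-++⁻ (map (x ∷_) (subseqs k xs)) ys∈
... | inj₂ ys∈′ = let ys⊆ , len = ∈-subseqs⁻ (suc k) xs ys∈′ in x ∷ʳ ys⊆ , len
... | inj₁ x∷ys∈ with ∈-map⁻ (x ∷_) x∷ys∈
...   | ys , ys∈′ , refl = let ys⊆ , len = ∈-subseqs⁻ k xs ys∈′ in refl ∷ ys⊆ , cong suc len

∈-subseqs⁺ : ∀ {ys xs} → ys ⊆ xs → ys ∈ subseqs (length ys) xs
∈-subseqs⁺ []                      = here refl
∈-subseqs⁺ {[]}     (x ∷ʳ ys⊆)     = here refl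
∈-subseqs⁺ {_ ∷ ys} (x ∷ʳ ys⊆)     = ∈-++⁺ʳ (map (x ∷_) (subseqs (length ys) _)) (∈-subseqs⁺ ys⊆)
∈-subseqs⁺          (refl ∷ ys⊆)   = ∈-++⁺ˡ (∈-map⁺ _ (∈-subseqs⁺ ys⊆))

orderIso-3231⁻ : ∀ {a b c d} → T (orderIso (a ∷ b ∷ c ∷ d ∷ []) pattern3231) → b < a × c ≡ a × d < b
orderIso-3231⁻ {a} {b} {c} {d} iso =
    <ᵇ⇒< b a (from (to T-⇔ᵇ (proj₁ (to T-∧ (agrees b₂ a₃)))) tt)
  , ≡ᵇ⇒≡ c a (from (to T-⇔ᵇ (proj₂ (to T-∧ (agrees c₃ a₃)))) tt)
  , <ᵇ⇒< d b (from (to T-⇔ᵇ (proj₁ (to T-∧ (agrees d₁ b₂)))) tt)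
  where
  pairs : List (ℕ × ℕ)
  pairs = (a , 3) ∷ (b , 2) ∷ (c , 3) ∷ (d , 1) ∷ []
  agreement : ℕ × ℕ → ℕ × ℕ → Bool
  agreement p q = ((proj₁ p <ᵇ proj₁ q) ⇔ᵇ (proj₂ p <ᵇ proj₂ q)) ∧ ((proj₁ p ≡ᵇ proj₁ q) ⇔ᵇ (proj₂ p ≡ᵇ proj₂ q))
  agrees : ∀ {p q} → p ∈ pairs → q ∈ pairs → T (agreement p q)
  agrees {p} p∈ q∈ =
    All.lookup (all⁺ (agreement p) pairs (All.lookup (all⁺ (λ p → all (agreement p) pairs) pairs iso) p∈)) q∈
  a₃ : (a , 3) ∈ pairs
  a₃ = here refl
  b₂ : (b , 2) ∈ pairs
  b₂ = there (here refl)
  c₃ : (c , 3) ∈ pairs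
  c₃ = there (there (here refl))
  d₁ : (d , 1) ∈ pairs
  d₁ = there (there (there (here refl)))

<ᵇ-true : ∀ {m n} → m < n → (m <ᵇ n) ≡ true
<ᵇ-true = to T-≡ ∘ <⇒<ᵇ

<ᵇ-false : ∀ {m n} → n ≤ m → (m <ᵇ n) ≡ false
<ᵇ-false {m} {n} n≤m = to T-not-≡ (from T-not (λ m<n → <⇒≱ (<ᵇ⇒< m n m<n) n≤m))

≡ᵇ-refl : ∀ m → (m ≡ᵇ m) ≡ true
≡ᵇ-refl m = to T-≡ (≡⇒≡ᵇ m m refl)

≡ᵇ-false : ∀ {m n} → m ≢ n → (m ≡ᵇ n) ≡ false
≡ᵇ-false {m} {n} m≢n = to T-not-≡ (from T-not (m≢n ∘ ≡ᵇ⇒≡ m n))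

orderIso-3231⁺ : ∀ {a b d} → d < b → b < a → T (orderIso (a ∷ b ∷ a ∷ d ∷ []) pattern3231)
orderIso-3231⁺ {a} {b} {d} d<b b<a = orderIso-3231⁺′ d<b b<a (<-trans d<b b<a)
  where
  orderIso-3231⁺′ : d < b → b < a → d < a → T (orderIso (a ∷ b ∷ a ∷ d ∷ []) pattern3231)
  orderIso-3231⁺′ d<b b<a d<a
      rewrite <ᵇ-true d<b | <ᵇ-true b<a | <ᵇ-true d<a
          | <ᵇ-false (<⇒≤ d<b) | <ᵇ-false (<⇒≤ b<a) | <ᵇ-false (<⇒≤ d<a)
          | <ᵇ-false (≤-refl {a}) | <ᵇ-false (≤-refl {b}) | <ᵇ-false (≤-refl {d})
          | ≡ᵇ-refl a | ≡ᵇ-refl b | ≡ᵇ-refl d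
          | ≡ᵇ-false (>⇒≢ b<a) | ≡ᵇ-false (<⇒≢ b<a) | ≡ᵇ-false (>⇒≢ d<b)
          | ≡ᵇ-false (<⇒≢ d<b) | ≡ᵇ-false (>⇒≢ d<a) | ≡ᵇ-false (<⇒≢ d<a) = tt

T-avoids : ∀ x → T (avoids x pattern3231) ⇔ (¬ Contains3231 x)
T-avoids x = mk⇔ (λ avoid has → to T-not avoid (contains⁺ has)) (λ ¬has → from T-not (¬has ∘ contains⁻))
  where
  contains⁺ : Contains3231 x → T (contains x pattern3231)
  contains⁺ (occurrence abac⊆ c<b b<a) = any⁺ _ (lose (∈-subseqs⁺ abac⊆) (orderIso-3231⁺ c<b b<a))
  contains⁻ : T (contains x pattern3231) → Contains3231 x
  contains⁻ has =
    let y , y∈ , iso = find (any⁻ (λ y → orderIso y pattern3231) (subseqs 4 x) has)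
        y⊆ , len = ∈-subseqs⁻ 4 x y∈
    in occurrenceOf y⊆ len iso
    where
    occurrenceOf : ∀ {y} → y ⊆ x → length y ≡ 4 → T (orderIso y pattern3231) → Contains3231 x
    occurrenceOf {a ∷ b ∷ c ∷ d ∷ []} y⊆ _ iso with orderIso-3231⁻ {a} {b} {c} {d} iso
    ... | b<a , refl , d<b = occurrence y⊆ d<b b<a
    occurrenceOf {[]}                      _ () _
    occurrenceOf {_ ∷ []}                  _ () _
    occurrenceOf {_ ∷ _ ∷ []}              _ () _
    occurrenceOf {_ ∷ _ ∷ _ ∷ []}          _ () _
    occurrenceOf {_ ∷ _ ∷ _ ∷ _ ∷ _ ∷ _}   _ () _

maxW-lub : ∀ {m} {x} → All (_≤ m) x → maxW x ≤ m
maxW-lub []           = z≤n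
maxW-lub (v≤m ∷ x≤m) = ⊔-lub v≤m (maxW-lub x≤m)

maxW-upper : ∀ x → All (_≤ maxW x) x
maxW-upper []      = []
maxW-upper (a ∷ x) = m≤m⊔n a (maxW x) ∷ All.map (λ v≤ → ≤-trans v≤ (m≤n⊔m a (maxW x))) (maxW-upper x)

maxW-∈ : ∀ a x → maxW (a ∷ x) ∈ a ∷ x
maxW-∈ a []      = here (⊔-identityʳ a)
maxW-∈ a (b ∷ x) with ⊔-sel a (maxW (b ∷ x))
... | inj₁ max≡a = here max≡a
... | inj₂ max≡m = subst (_∈ a ∷ b ∷ x) (sym max≡m) (there (maxW-∈ b x))

maxW-head : ∀ {h t} → All (_≤ h) t → maxW (h ∷ t) ≡ h
maxW-head t≤h = ≤-antisym (⊔-lub ≤-refl (maxW-lub t≤h)) (m≤m⊔n _ _)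

record Ras3231 (x : Word) : Set where
  field
    positive   : All (1 ≤_) x
    cayley     : ∀ i → i < maxW x → suc i ∈ x
    ascbot≡nub : T (ascbotEqNub x)
    avoids3231 : ¬ Contains3231 x

T-isCayley : ∀ x → T (isCayley x) ⇔ (∀ i → i < maxW x → suc i ∈ x)
T-isCayley x = mk⇔
  (λ c i i<m → to (T-elem x) (All.lookup (all⁺ _ (upTo (maxW x)) c) (∈-upTo⁺ i<m)))
  (λ c → all⁻ _ (All.tabulate (λ {i} i∈ → from (T-elem x) (c i (∈-upTo⁻ i∈)))))

T-inRange : ∀ {n v} → T ((0 <ᵇ v) ∧ ((v <ᵇ n) ∨ (v ≡ᵇ n))) ⇔ (1 ≤ v × v ≤ n)
T-inRange {n} {v} = mk⇔
  (λ t → let pos , le = to T-∧ t in <ᵇ⇒< 0 v pos , [ <⇒≤ ∘ <ᵇ⇒< v n , ≤-reflexive ∘ ≡ᵇ⇒≡ v n ]′ (to T-∨ le))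
  (λ (1≤v , v≤n) → from T-∧ (<⇒<ᵇ 1≤v , from T-∨ ([ inj₁ ∘ <⇒<ᵇ , inj₂ ∘ ≡⇒≡ᵇ v n ]′ (m≤n⇒m<n∨m≡n v≤n))))

T-inBhat : ∀ {n x} → T (inBhat n pattern3231 x) ⇔ (length x ≡ n × All (_≤ n) x × Ras3231 x)
T-inBhat {n} {x} = mk⇔ split join
  where
  inRange : ℕ → Bool
  inRange v = (0 <ᵇ v) ∧ ((v <ᵇ n) ∨ (v ≡ᵇ n))
  split : T (inBhat n pattern3231 x) → length x ≡ n × All (_≤ n) x × Ras3231 x
  split t =
    let endo , ras∧avoid = to (T-∧ {isEndo n x}) t
        ras , avoid = to (T-∧ {isRAS x}) ras∧avoid
        len , range = to (T-∧ {length x ≡ᵇ n}) endo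
        cay , asc = to (T-∧ {isCayley x}) ras
        pos , bounded = All.unzip (All.map (to T-inRange) (all⁺ inRange x range))
    in ≡ᵇ⇒≡ (length x) n len , bounded ,
       record { positive = pos ; cayley = to (T-isCayley x) cay ; ascbot≡nub = asc ; avoids3231 = to (T-avoids x) avoid }
  join : length x ≡ n × All (_≤ n) x × Ras3231 x → T (inBhat n pattern3231 x)
  join (len , bounded , ras) =
    from T-∧ (from T-∧ (≡⇒≡ᵇ (length x) n len , all⁻ inRange (All.map (from T-inRange) (All.zip (positive , bounded)))) ,
              from T-∧ (from T-∧ (from (T-isCayley x) cayley , ascbot≡nub) , from (T-avoids x) avoids3231))
    where open Ras3231 ras

at0-≤ : ∀ {m r} → All (_≤ m) r → at r 0 ≤ m
at0-≤ []        = z≤n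
at0-≤ (v≤m ∷ _) = v≤m

∉-++-[] : ∀ {v u : ℕ} (seen : Word) → v ∉ seen → v ≢ u → v ∉ seen ++ [ u ]
∉-++-[] seen v∉ v≢u v∈ with ∈-++⁻ seen v∈
... | inj₁ v∈seen      = v∉ v∈seen
... | inj₂ (here v≡u)  = v≢u v≡u

∈-∷-≢ : ∀ {v u : ℕ} {r : Word} → v ∈ u ∷ r → v ≢ u → v ∈ r
∈-∷-≢ (here v≡u) v≢u = ⊥-elim (v≢u v≡u)
∈-∷-≢ (there v∈) _   = v∈

-- The first occurrence of a maximum would have to ascend to something larger.
maximum-not-new : ∀ {seen r m} → NewIffAscent seen r → m ∈ r → All (_≤ m) r → m ∉ seen → ⊥
maximum-not-new {seen} {u ∷ r} {m} valid@(_ ∷ rest) m∈ (_ ∷ r≤m) m∉ with m ≟ u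
... | yes refl = <⇒≱ (new⇒ascent valid m∉) (at0-≤ r≤m)
... | no m≢u   = maximum-not-new rest (∈-∷-≢ m∈ m≢u) r≤m (∉-++-[] seen m∉ m≢u)

head-is-maximum : ∀ {h t} → NewIffAscent [ h ] t → All (_≤ h) t
head-is-maximum {h} {t} valid with maxW (h ∷ t) ≟ h
... | yes max≡h = subst (λ m → All (_≤ m) t) max≡h (All.tail (maxW-upper (h ∷ t)))
... | no max≢h  = ⊥-elim (maximum-not-new valid (∈-∷-≢ (maxW-∈ h t) max≢h) (All.tail (maxW-upper (h ∷ t)))
                                       λ { (here max≡h) → max≢h max≡h })

-- Following the ascents from a new letter b, the first letter b′ that is not new
-- occurred before b, and b′ b b′ c is an occurrence.
new-then-smaller⇒3231 : ∀ seen b r {c} → NewIffAscent seen (b ∷ r) → b ∉ seen → c ∈ r → c < b →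
                        Contains3231 (seen ++ b ∷ r)
new-then-smaller⇒3231 seen b (b′ ∷ r) valid b∉ (here refl)  c<b = ⊥-elim (<-asym c<b (new⇒ascent valid b∉))
new-then-smaller⇒3231 seen b (b′ ∷ r) valid b∉ (there c∈r) c<b with b′ ∈? seen ++ [ b ]
... | yes b′∈ with ∈-++⁻ seen b′∈
...   | inj₁ b′∈seen     = occurrence (++⁺ (from∈ b′∈seen) (refl ∷ refl ∷ from∈ c∈r)) c<b (new⇒ascent valid b∉)
...   | inj₂ (here refl) = ⊥-elim (<-irrefl refl (new⇒ascent valid b∉))
new-then-smaller⇒3231 seen b (b′ ∷ r) valid@(_ ∷ rest) b∉ (there c∈r) c<b | no b′∉ =
  subst Contains3231 (++-assoc seen [ b ] (b′ ∷ r))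
        (new-then-smaller⇒3231 (seen ++ [ b ]) b′ r rest b′∉ c∈r (<-trans c<b (new⇒ascent valid b∉)))

ones-after-repeated-one : ∀ {seen r} → NewIffAscent seen (1 ∷ r) → 1 ∈ seen → All (1 ≤_) r → All (_≡ 1) r
ones-after-repeated-one {r = []}    _                  _   []            = []
ones-after-repeated-one {r = v ∷ r} valid@(_ ∷ rest) 1∈ (1≤v ∷ 1≤r)
  with ≤-antisym (seen⇒descent valid 1∈) 1≤v
... | refl = refl ∷ ones-after-repeated-one rest (∈-++⁺ˡ 1∈) 1≤r

-- Whichever of 1 and 2 comes first in r decides: a repeated 1 forces all later
-- letters to be 1, while a new 2 followed by a 1 is caught by new-then-smaller⇒3231.
new-two-and-one⇒3231 : ∀ {seen r} → NewIffAscent seen r → 1 ∈ seen → 2 ∉ seen → 1 ∈ r → 2 ∈ r →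
                       All (1 ≤_) r → Contains3231 (seen ++ r)
new-two-and-one⇒3231 {seen} {u ∷ r} valid@(_ ∷ rest) 1∈ 2∉ 1∈r 2∈r (_ ∷ 1≤r) with u ≟ 1 | u ≟ 2
... | no u≢1 | yes refl = new-then-smaller⇒3231 seen 2 r valid 2∉ (∈-∷-≢ 1∈r (u≢1 ∘ sym)) (s≤s (s≤s z≤n))
... | no u≢1 | no u≢2   =
  subst Contains3231 (++-assoc seen [ u ] r)
        (new-two-and-one⇒3231 rest (∈-++⁺ˡ 1∈) (∉-++-[] seen 2∉ (u≢2 ∘ sym))
                              (∈-∷-≢ 1∈r (u≢1 ∘ sym)) (∈-∷-≢ 2∈r (u≢2 ∘ sym)) 1≤r)
... | yes refl | _ with All.lookup (ones-after-repeated-one valid 1∈ 1≤r) (∈-∷-≢ 2∈r λ ())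
...   | ()

twosThenOnes : ∀ {k} → Fin k → Word
twosThenOnes {suc k} zero    = 2 ∷ replicate k 1
twosThenOnes {suc k} (suc o) = 2 ∷ twosThenOnes o

All-≡⇒replicate : ∀ {v : ℕ} {xs} → All (_≡ v) xs → xs ≡ replicate (length xs) v
All-≡⇒replicate []            = refl
All-≡⇒replicate (refl ∷ xs≡v) = cong (_ ∷_) (All-≡⇒replicate xs≡v)

one-or-two : ∀ {v} → 1 ≤ v → v ≤ 2 → v ≡ 1 ⊎ v ≡ 2
one-or-two {1} _ _ = inj₁ refl
one-or-two {2} _ _ = inj₂ refl
one-or-two {suc (suc (suc _))} _ (s≤s (s≤s ()))

tail-is-twosThenOnes : ∀ {seen t} → NewIffAscent seen (2 ∷ t) → 1 ∈ seen → 2 ∈ seen →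
                       All (1 ≤_) t → All (_≤ 2) t → ∃[ o ] twosThenOnes {suc (length t)} o ≡ 2 ∷ t
tail-is-twosThenOnes {t = []}    _                _  _  _           _           = zero , refl
tail-is-twosThenOnes {t = v ∷ t} valid@(_ ∷ rest) 1∈ 2∈ (1≤v ∷ 1≤t) (v≤2 ∷ t≤2) with one-or-two 1≤v v≤2
... | inj₁ refl = zero , cong (λ w → 2 ∷ 1 ∷ w) (sym (All-≡⇒replicate (ones-after-repeated-one rest (∈-++⁺ˡ 1∈) 1≤t)))
... | inj₂ refl = let o , ≡t = tail-is-twosThenOnes rest (∈-++⁺ˡ 1∈) (∈-++⁺ˡ 2∈) 1≤t t≤2 in suc o , cong (2 ∷_) ≡t

length-twosThenOnes : ∀ {k} (o : Fin k) → length (twosThenOnes o) ≡ k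
length-twosThenOnes {suc k} zero    = cong suc (length-replicate k)
length-twosThenOnes {suc k} (suc o) = cong suc (length-twosThenOnes o)

at0-twosThenOnes : ∀ {k} (o : Fin k) → at (twosThenOnes o) 0 ≡ 2
at0-twosThenOnes zero    = refl
at0-twosThenOnes (suc o) = refl

twosThenOnes-injective : ∀ {k} {o o′ : Fin k} → twosThenOnes o ≡ twosThenOnes o′ → o ≡ o′
twosThenOnes-injective {o = zero}  {zero}   _  = refl
twosThenOnes-injective {o = suc o} {suc o′} eq = cong suc (twosThenOnes-injective (∷-injectiveʳ eq))
twosThenOnes-injective {suc (suc _)} {zero}  {suc o′} eq with () ← trans (cong (λ w → at w 1) eq) (at0-twosThenOnes o′)
twosThenOnes-injective {suc (suc _)} {suc o} {zero}   eq with () ← trans (cong (λ w → at w 1) (sym eq)) (at0-twosThenOnes o)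

NewIffAscent-cong : ∀ {seen seen′ r} → (∀ {v} → v ∈ r → (v ∈ seen ⇔ v ∈ seen′)) →
                    NewIffAscent seen r → NewIffAscent seen′ r
NewIffAscent-cong same [] = []
NewIffAscent-cong {seen} {seen′} {u ∷ r} same (u⇔ ∷ rest) =
  ⇔-transport (mk⇔ id id) (¬-cong-⇔ (same (here refl))) u⇔ ∷ NewIffAscent-cong same′ rest
  where
  same′ : ∀ {v} → v ∈ r → (v ∈ seen ++ [ u ] ⇔ v ∈ seen′ ++ [ u ])
  same′ v∈ = mk⇔ ([ ∈-++⁺ˡ ∘ to (same (there v∈))   , ∈-++⁺ʳ seen′ ]′ ∘ ∈-++⁻ seen)
                 ([ ∈-++⁺ˡ ∘ from (same (there v∈)) , ∈-++⁺ʳ seen  ]′ ∘ ∈-++⁻ seen′)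

suc-<-at : ∀ {u} r → suc u < at (map suc r) 0 ⇔ u < at r 0
suc-<-at []      = mk⇔ (λ ()) (λ ())
suc-<-at (_ ∷ _) = mk⇔ s<s⁻¹ s<s

suc-∈-map : ∀ {u} xs → suc u ∈ map suc xs ⇔ u ∈ xs
suc-∈-map xs = mk⇔ (λ su∈ → let _ , w∈ , su≡sw = ∈-map⁻ suc su∈ in subst (_∈ xs) (sym (suc-injective su≡sw)) w∈)
                   (∈-map⁺ suc)

NewIffAscent-map-suc⁺ : ∀ {seen r} → NewIffAscent seen r → NewIffAscent (map suc seen) (map suc r)
NewIffAscent-map-suc⁺ [] = []
NewIffAscent-map-suc⁺ {seen} {u ∷ r} (u⇔ ∷ rest) =
  ⇔-transport (⇔-sym (suc-<-at r)) (¬-cong-⇔ (⇔-sym (suc-∈-map seen))) u⇔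
  ∷ subst (λ s → NewIffAscent s (map suc r)) (map-++ suc seen [ u ]) (NewIffAscent-map-suc⁺ rest)

NewIffAscent-map-suc⁻ : ∀ {seen r} → NewIffAscent (map suc seen) (map suc r) → NewIffAscent seen r
NewIffAscent-map-suc⁻ {seen} {[]}    []            = []
NewIffAscent-map-suc⁻ {seen} {u ∷ r} (u⇔ ∷ rest) =
  ⇔-transport (suc-<-at r) (¬-cong-⇔ (suc-∈-map seen)) u⇔
  ∷ NewIffAscent-map-suc⁻ (subst (λ s → NewIffAscent s (map suc r)) (sym (map-++ suc seen [ u ])) rest)

ascents : ∀ {h t} → Ras3231 (h ∷ t) → NewIffAscent [ h ] t
ascents = to T-ascbotEqNub-∷ ∘ Ras3231.ascbot≡nub

tail-≤-head : ∀ {h t} → Ras3231 (h ∷ t) → All (_≤ h) t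
tail-≤-head = head-is-maximum ∘ ascents

dupHead : Word → Word
dupHead []      = []
dupHead (h ∷ t) = h ∷ h ∷ t

maxW-dupHead : ∀ h t → maxW (dupHead (h ∷ t)) ≡ maxW (h ∷ t)
maxW-dupHead h t = trans (sym (⊔-assoc h h (maxW t))) (cong (_⊔ maxW t) (⊔-idem h))

∈-dupHead : ∀ {v h t} → v ∈ dupHead (h ∷ t) ⇔ v ∈ h ∷ t
∈-dupHead = mk⇔ (λ { (here v≡h) → here v≡h ; (there v∈) → v∈ }) there

Contains3231-dupHead⁻ : ∀ {h t} → Contains3231 (dupHead (h ∷ t)) → Contains3231 (h ∷ t)
Contains3231-dupHead⁻ (occurrence (_ ∷ʳ abac⊆)          c<b b<a) = occurrence abac⊆ c<b b<a
Contains3231-dupHead⁻ (occurrence (refl ∷ (_ ∷ʳ bac⊆)) c<b b<a) = occurrence (refl ∷ bac⊆) c<b b<a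
Contains3231-dupHead⁻ (occurrence (refl ∷ (refl ∷ _))  c<b b<a) = ⊥-elim (<-irrefl refl b<a)

Contains3231-dupHead⁺ : ∀ {h t} → Contains3231 (h ∷ t) → Contains3231 (dupHead (h ∷ t))
Contains3231-dupHead⁺ {h} (occurrence abac⊆ c<b b<a) = occurrence (h ∷ʳ abac⊆) c<b b<a

Ras3231-dupHead⁺ : ∀ {h t} → Ras3231 (h ∷ t) → Ras3231 (dupHead (h ∷ t))
Ras3231-dupHead⁺ {h} {t} ras = record
  { positive   = All.head positive ∷ positive
  ; cayley     = λ i i< → from ∈-dupHead (cayley i (subst (i <_) (maxW-dupHead h t) i<))
  ; ascbot≡nub = from T-ascbotEqNub-∷ (seen-∷ (here refl) (at0-≤ (tail-≤-head ras))
                                               (NewIffAscent-cong (λ _ → ⇔-sym ∈-dupHead) (ascents ras)))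
  ; avoids3231 = avoids3231 ∘ Contains3231-dupHead⁻
  }
  where open Ras3231 ras

Ras3231-dupHead⁻ : ∀ {h t} → Ras3231 (dupHead (h ∷ t)) → Ras3231 (h ∷ t)
Ras3231-dupHead⁻ {h} {t} ras = record
  { positive   = All.tail positive
  ; cayley     = λ i i< → to ∈-dupHead (cayley i (subst (i <_) (sym (maxW-dupHead h t)) i<))
  ; ascbot≡nub = from T-ascbotEqNub-∷ (NewIffAscent-cong (λ _ → ∈-dupHead) (NewIffAscent-tail (ascents ras)))
  ; avoids3231 = avoids3231 ∘ Contains3231-dupHead⁺
  }
  where open Ras3231 ras

raise : Word → Word
raise []      = []
raise (h ∷ t) = suc h ∷ 1 ∷ map suc t

All-positive-map-suc : ∀ l → All (1 ≤_) (map suc l)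
All-positive-map-suc []      = []
All-positive-map-suc (_ ∷ l) = s≤s z≤n ∷ All-positive-map-suc l

1⊔maxW-map-suc : ∀ l → 1 ⊔ maxW (map suc l) ≡ suc (maxW l)
1⊔maxW-map-suc []      = refl
1⊔maxW-map-suc (v ∷ l) = begin
  1 ⊔ (suc v ⊔ m)    ≡⟨ sym (⊔-assoc 1 (suc v) m) ⟩
  (1 ⊔ suc v) ⊔ m    ≡⟨ cong (_⊔ m) (⊔-comm 1 (suc v)) ⟩
  (suc v ⊔ 1) ⊔ m    ≡⟨ ⊔-assoc (suc v) 1 m ⟩
  suc v ⊔ (1 ⊔ m)    ≡⟨ cong (suc v ⊔_) (1⊔maxW-map-suc l) ⟩
  suc (v ⊔ maxW l)   ∎
  where
  open ≡-Reasoning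
  m : ℕ
  m = maxW (map suc l)

maxW-raise : ∀ h t → maxW (raise (h ∷ t)) ≡ suc (maxW (h ∷ t))
maxW-raise h t = cong (suc h ⊔_) (1⊔maxW-map-suc t)

suc-∈-raise : ∀ {v h t} → suc v ∈ h ∷ t ⇔ suc (suc v) ∈ raise (h ∷ t)
suc-∈-raise {t = t} = mk⇔ (λ { (here v≡h) → here (cong suc v≡h) ; (there v∈) → there (there (∈-map⁺ suc v∈)) })
                          (λ { (here v≡h) → here (suc-injective v≡h) ; (there (there v∈)) → there (to (suc-∈-map t) v∈) })

cayley-raise : ∀ {h t} → (∀ i → i < maxW (h ∷ t) → suc i ∈ h ∷ t) ⇔ (∀ i → i < maxW (raise (h ∷ t)) → suc i ∈ raise (h ∷ t))
cayley-raise {h} {t} = mk⇔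
  (λ { cay zero    _  → there (here refl)
     ; cay (suc i) i< → to suc-∈-raise (cay i (s<s⁻¹ (subst (suc i <_) (maxW-raise h t) i<))) })
  (λ cay i i< → from suc-∈-raise (cay (suc i) (subst (suc i <_) (sym (maxW-raise h t)) (s<s i<))))

insert-second : ∀ {ys : Word} {u v L} → ys ⊆ u ∷ L → ys ⊆ u ∷ v ∷ L
insert-second (refl ∷ ys⊆) = refl ∷ (_ ∷ʳ ys⊆)
insert-second (u ∷ʳ ys⊆)   = u ∷ʳ (_ ∷ʳ ys⊆)

-- The inserted 1 cannot play any role in 3231, since the entries are positive.
Contains3231-raise⁻ : ∀ {h t} → Contains3231 (raise (h ∷ t)) → Contains3231 (h ∷ t)
Contains3231-raise⁻ {h} {t} (occurrence {a} {b} {c} abac⊆ c<b b<a)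
  with All-resp-⊆ abac⊆ (s≤s z≤n ∷ s≤s z≤n ∷ All-positive-map-suc t)
... | _ ∷ _ ∷ _ ∷ 1≤c ∷ [] =
  occurrence (subst (map pred (a ∷ b ∷ a ∷ c ∷ []) ⊆_) (cong (h ∷_) (map-pred∘suc t)) (map⁺ pred (delete-one abac⊆)))
             (pred-< 1≤c c<b) (pred-< (≤-trans 1≤c (<⇒≤ c<b)) b<a)
  where
  1<b : 1 < b
  1<b = ≤-trans (s≤s 1≤c) c<b
  delete-one : a ∷ b ∷ a ∷ c ∷ [] ⊆ raise (h ∷ t) → a ∷ b ∷ a ∷ c ∷ [] ⊆ suc h ∷ map suc t
  delete-one (refl ∷ (_ ∷ʳ bac⊆))  = refl ∷ bac⊆
  delete-one (_ ∷ʳ (_ ∷ʳ abac⊆))   = _ ∷ʳ abac⊆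
  delete-one (refl ∷ (refl ∷ _))   = ⊥-elim (<-irrefl refl 1<b)
  delete-one (_ ∷ʳ (refl ∷ _))     = ⊥-elim (<-asym 1<b b<a)
  map-pred∘suc : ∀ (l : Word) → map pred (map suc l) ≡ l
  map-pred∘suc l = trans (sym (map-∘ l)) (map-id l)
  pred-< : ∀ {m n} → 1 ≤ m → m < n → pred m < pred n
  pred-< {suc m} {suc n} _ m<n = s<s⁻¹ m<n

Contains3231-raise⁺ : ∀ {h t} → Contains3231 (h ∷ t) → Contains3231 (raise (h ∷ t))
Contains3231-raise⁺ (occurrence abac⊆ c<b b<a) = occurrence (insert-second (map⁺ ℕ.suc abac⊆)) (s<s c<b) (s<s b<a)

seen-one-irrelevant : ∀ {h l} → All (1 ≤_) l → ∀ {v} → v ∈ map suc l → (v ∈ [ suc h ] ⇔ v ∈ [ suc h ] ++ [ 1 ])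
seen-one-irrelevant {l = l} 1≤l v∈ = mk⇔ (λ { (here v≡) → here v≡ })
  (λ { (here v≡) → here v≡ ; (there (here refl)) → ⊥-elim (<-irrefl refl (All.lookup (All-map⁺ {P = 2 ≤_} (All.map s≤s 1≤l)) v∈)) })

Ras3231-raise⁺ : ∀ {h b t} → Ras3231 (h ∷ b ∷ t) → Ras3231 (raise (h ∷ b ∷ t))
Ras3231-raise⁺ {h} {b} {t} ras = record
  { positive   = s≤s z≤n ∷ s≤s z≤n ∷ All-positive-map-suc (b ∷ t)
  ; cayley     = to cayley-raise cayley
  ; ascbot≡nub = from T-ascbotEqNub-∷
      (new-∷ 1∉ (s<s 1≤b) (NewIffAscent-cong (seen-one-irrelevant 1≤b∷t) (NewIffAscent-map-suc⁺ (ascents ras))))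
  ; avoids3231 = avoids3231 ∘ Contains3231-raise⁻
  }
  where
  open Ras3231 ras
  1≤b∷t : All (1 ≤_) (b ∷ t)
  1≤b∷t = All.tail positive
  1≤b : 1 ≤ b
  1≤b = All.head 1≤b∷t
  1∉ : 1 ∉ [ suc h ]
  1∉ (here 1≡sh) = <-irrefl 1≡sh (s<s (All.head positive))

Ras3231-raise⁻ : ∀ {h b t} → All (1 ≤_) (h ∷ b ∷ t) → Ras3231 (raise (h ∷ b ∷ t)) → Ras3231 (h ∷ b ∷ t)
Ras3231-raise⁻ {h} {b} {t} 1≤x ras = record
  { positive   = 1≤x
  ; cayley     = from cayley-raise cayley
  ; ascbot≡nub = from T-ascbotEqNub-∷ (NewIffAscent-map-suc⁻
      (NewIffAscent-cong (⇔-sym ∘ seen-one-irrelevant (All.tail 1≤x)) (NewIffAscent-tail (ascents ras))))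
  ; avoids3231 = avoids3231 ∘ Contains3231-raise⁺
  }
  where open Ras3231 ras

data Shape : Word → Set where
  ones       : ∀ n → Shape (replicate n 1)
  duplicated : ∀ {h t} → 2 ≤ h → Ras3231 (h ∷ t) → Shape (dupHead (h ∷ t))
  twos       : ∀ {k} (o : Fin k) → Shape (2 ∷ 1 ∷ twosThenOnes o)
  raised     : ∀ {h b t} → 2 ≤ h → Ras3231 (h ∷ b ∷ t) → Shape (raise (h ∷ b ∷ t))

one-after-head-ascends : ∀ {h t} → 2 ≤ h → Ras3231 (h ∷ 1 ∷ t) → 1 < at t 0
one-after-head-ascends 2≤h ras = new⇒ascent (ascents ras) λ { (here 1≡h) → <-irrefl 1≡h 2≤h }

map-suc-preimage : ∀ {l} → All (2 ≤_) l → ∃[ l′ ] map suc l′ ≡ l × All (1 ≤_) l′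
map-suc-preimage []                  = [] , refl , []
map-suc-preimage (s≤s 1≤v ∷ 2≤l) = let l′ , ≡l , 1≤l′ = map-suc-preimage 2≤l in _ ∷ l′ , cong (_ ∷_) ≡l , 1≤v ∷ 1≤l′

shape-twos : ∀ {t} → Ras3231 (2 ∷ 1 ∷ t) → Shape (2 ∷ 1 ∷ t)
shape-twos {[]}    ras with () ← one-after-head-ascends ≤-refl ras
shape-twos {z ∷ t} ras with ≤-antisym (All.lookup (tail-≤-head ras) (there (here refl))) (one-after-head-ascends ≤-refl ras)
... | refl = let o , ≡t = tail-is-twosThenOnes (NewIffAscent-tail (ascents ras)) (there (here refl)) (here refl)
                                         (All.tail (All.tail (All.tail positive))) (All.tail (All.tail (tail-≤-head ras)))
             in subst Shape (cong (λ w → 2 ∷ 1 ∷ w) ≡t) (twos o)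
  where open Ras3231 ras

-- As h ≥ 3 is the maximum, 2 occurs in t, so a 1 in t would give a 3231.
tail-≥2-after-large-head : ∀ {h t} → 3 ≤ h → Ras3231 (h ∷ 1 ∷ t) → All (2 ≤_) t
tail-≥2-after-large-head {h} {t} 3≤h ras =
  All.tabulate λ {v} v∈ → ≤∧≢⇒< (All.lookup positive (there (there v∈))) λ { refl → 1∉t v∈ }
  where
  open Ras3231 ras
  2∈t : 2 ∈ t
  2∈t = ∈-∷-≢ (∈-∷-≢ (cayley 1 (subst (1 <_) (sym (maxW-head (tail-≤-head ras))) (<⇒≤ 3≤h)))
                       (λ 2≡h → <-irrefl 2≡h 3≤h)) λ ()
  1∉t : 1 ∉ t
  1∉t 1∈t = avoids3231 (new-two-and-one⇒3231 (NewIffAscent-tail (ascents ras)) (there (here refl))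
                          (λ { (here 2≡h) → <-irrefl 2≡h 3≤h ; (there (here ())) }) 1∈t 2∈t (All.tail (All.tail positive)))

shape-raised : ∀ {h t} → 3 ≤ h → Ras3231 (h ∷ 1 ∷ t) → Shape (h ∷ 1 ∷ t)
shape-raised {suc h′} 3≤h ras with map-suc-preimage (tail-≥2-after-large-head 3≤h ras)
... | []     , refl , _    with () ← one-after-head-ascends (<⇒≤ 3≤h) ras
... | b ∷ t′ , refl , 1≤l′ = raised (s≤s⁻¹ 3≤h) (Ras3231-raise⁻ (≤-trans (s≤s z≤n) (s≤s⁻¹ 3≤h) ∷ 1≤l′) ras)

one-in-tail : ∀ {h t} → 2 ≤ h → Ras3231 (h ∷ t) → 1 ∈ t
one-in-tail 2≤h ras =
  ∈-∷-≢ (cayley 0 (subst (0 <_) (sym (maxW-head (tail-≤-head ras))) (≤-trans (n≤1+n 1) 2≤h))) λ { refl → <-irrefl refl 2≤h }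
  where open Ras3231 ras

-- A second letter y ∉ {1, h} is new, so it would ascend and the 1 after it completes a 3231.
shape-≥2 : ∀ {h t} → 2 ≤ h → Ras3231 (h ∷ t) → Shape (h ∷ t)
shape-≥2 {h} {[]}    2≤h ras with () ← one-in-tail 2≤h ras
shape-≥2 {h} {y ∷ t} 2≤h ras with y ≟ h | y ≟ 1
... | yes refl | _        = duplicated 2≤h (Ras3231-dupHead⁻ ras)
... | no y≢h   | no y≢1   =
  ⊥-elim (avoids3231 (new-then-smaller⇒3231 [ h ] y t (ascents ras) (λ { (here y≡h) → y≢h y≡h })
                                            (∈-∷-≢ (one-in-tail 2≤h ras) (y≢1 ∘ sym))
                                            (≤∧≢⇒< (All.lookup positive (there (here refl))) (y≢1 ∘ sym))))
  where open Ras3231 ras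
... | no _     | yes refl with h ≟ 2
...   | yes refl = shape-twos ras
...   | no h≢2   = shape-raised (≤∧≢⇒< 2≤h (h≢2 ∘ sym)) ras

tail-all-ones : ∀ {t} → Ras3231 (1 ∷ t) → t ≡ replicate (length t) 1
tail-all-ones ras = All-≡⇒replicate (All.zipWith (uncurry ≤-antisym) (tail-≤-head ras , All.tail (Ras3231.positive ras)))

shape : ∀ {x} → Ras3231 x → Shape x
shape {[]}    _   = ones 0
shape {h ∷ t} ras with h ≟ 1
... | yes refl = subst Shape (cong (1 ∷_) (sym (tail-all-ones ras))) (ones (suc (length t)))
... | no h≢1 = shape-≥2 (≤∧≢⇒< (All.head positive) (h≢1 ∘ sym)) ras
  where open Ras3231 ras

-- Code k names the words of B̂ₖ₊₁(3231) other than 1ᵏ⁺¹ by the steps of Shape that build them.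
data Code : ℕ → Set where
  duplicated : ∀ {k} → Code k → Code (suc k)
  twos       : ∀ {k} → Fin k → Code (suc k)
  raised     : ∀ {k} → Code k → Code (suc k)

decode : ∀ {k} → Code k → Word
decode (duplicated c) = dupHead (decode c)
decode (twos o)       = 2 ∷ 1 ∷ twosThenOnes o
decode (raised c)     = raise (decode c)

¬Contains3231-≤2 : ∀ {x} → All (λ v → 1 ≤ v × v ≤ 2) x → ¬ Contains3231 x
¬Contains3231-≤2 bounds (occurrence abac⊆ c<b b<a) with All-resp-⊆ abac⊆ bounds
... | (_ , a≤2) ∷ _ ∷ _ ∷ (1≤c , _) ∷ [] = <⇒≱ (≤-trans (s≤s (≤-trans (s≤s 1≤c) c<b)) b<a) a≤2

cayley-from-bound : ∀ {m x} → All (_≤ m) x → (∀ i → i < m → suc i ∈ x) → ∀ i → i < maxW x → suc i ∈ x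
cayley-from-bound x≤m cay i i<max = cay i (<-≤-trans i<max (maxW-lub x≤m))

NewIffAscent-ones : ∀ {seen} k → 1 ∈ seen → NewIffAscent seen (replicate k 1)
NewIffAscent-ones zero    _  = []
NewIffAscent-ones (suc k) 1∈ = seen-∷ 1∈ (at0-≤ (replicate⁺ k ≤-refl)) (NewIffAscent-ones k (∈-++⁺ˡ 1∈))

Ras3231-ones : ∀ k → Ras3231 (replicate (suc k) 1)
Ras3231-ones k = record
  { positive   = replicate⁺ (suc k) ≤-refl
  ; cayley     = cayley-from-bound (replicate⁺ (suc k) ≤-refl) λ { zero _ → here refl ; (suc _) (s≤s ()) }
  ; ascbot≡nub = from T-ascbotEqNub-∷ (NewIffAscent-ones k (here refl))
  ; avoids3231 = ¬Contains3231-≤2 (replicate⁺ (suc k) (≤-refl , s≤s z≤n))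
  }

twosThenOnes-bounds : ∀ {k} (o : Fin k) → All (λ v → 1 ≤ v × v ≤ 2) (twosThenOnes o)
twosThenOnes-bounds {suc k} zero    = (s≤s z≤n , ≤-refl) ∷ replicate⁺ k (≤-refl , s≤s z≤n)
twosThenOnes-bounds {suc k} (suc o) = (s≤s z≤n , ≤-refl) ∷ twosThenOnes-bounds o

NewIffAscent-twosThenOnes : ∀ {seen k} (o : Fin k) → 1 ∈ seen → 2 ∈ seen → NewIffAscent seen (twosThenOnes o)
NewIffAscent-twosThenOnes {k = suc k} zero 1∈ 2∈ =
  seen-∷ 2∈ (at0-≤ (replicate⁺ k (s≤s z≤n))) (NewIffAscent-ones k (∈-++⁺ˡ 1∈))
NewIffAscent-twosThenOnes (suc o) 1∈ 2∈ =
  seen-∷ 2∈ (≤-reflexive (at0-twosThenOnes o)) (NewIffAscent-twosThenOnes o (∈-++⁺ˡ 1∈) (∈-++⁺ˡ 2∈))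

Ras3231-twos : ∀ {k} (o : Fin k) → Ras3231 (2 ∷ 1 ∷ twosThenOnes o)
Ras3231-twos o = record
  { positive   = All.map proj₁ bounds
  ; cayley     = cayley-from-bound (All.map proj₂ bounds)
                   λ { zero _ → there (here refl) ; (suc zero) _ → here refl ; (suc (suc _)) (s≤s (s≤s ())) }
  ; ascbot≡nub = from T-ascbotEqNub-∷ (new-∷ (λ { (here ()) }) (≤-reflexive (sym (at0-twosThenOnes o)))
                                             (NewIffAscent-twosThenOnes o (there (here refl)) (here refl)))
  ; avoids3231 = ¬Contains3231-≤2 bounds
  }
  where
  bounds : All (λ v → 1 ≤ v × v ≤ 2) (2 ∷ 1 ∷ twosThenOnes o)
  bounds = (s≤s z≤n , ≤-refl) ∷ (≤-refl , s≤s z≤n) ∷ twosThenOnes-bounds o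

record Decoded (k : ℕ) (x : Word) : Set where
  field
    ras      : Ras3231 x
    length≡  : length x ≡ suc k
    2≤head   : 2 ≤ at x 0
    head≤    : at x 0 ≤ suc k

Code-zero-empty : ¬ Code 0
Code-zero-empty ()

decode-sound : ∀ {k} (c : Code k) → Decoded k (decode c)
decode-sound (twos o) = record
  { ras = Ras3231-twos o ; length≡ = cong (ℕ.suc ∘ ℕ.suc) (length-twosThenOnes o) ; 2≤head = ≤-refl ; head≤ = s≤s (s≤s z≤n) }
decode-sound (duplicated c) with decode c | decode-sound c
... | []    | record { length≡ = () }
... | h ∷ t | d = record
  { ras = Ras3231-dupHead⁺ ras ; length≡ = cong suc length≡ ; 2≤head = 2≤head ; head≤ = m≤n⇒m≤1+n head≤ }
  where open Decoded d
decode-sound (raised c) with decode c | decode-sound c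
... | []    | record { length≡ = () }
... | _ ∷ [] | record { length≡ = 1≡1+k } = ⊥-elim (Code-zero-empty (subst Code (sym (suc-injective 1≡1+k)) c))
... | h ∷ b ∷ t | d = record
  { ras = Ras3231-raise⁺ ras ; length≡ = cong suc (trans (cong (ℕ.suc ∘ ℕ.suc) (length-map ℕ.suc t)) length≡)
  ; 2≤head = m≤n⇒m≤1+n 2≤head ; head≤ = s≤s head≤ }
  where open Decoded d

decode-bounded : ∀ {k} (c : Code k) → All (_≤ suc k) (decode c)
decode-bounded c with decode c | decode-sound c
... | []    | _ = []
... | h ∷ t | d = head≤ ∷ All.map (λ v≤h → ≤-trans v≤h head≤) (tail-≤-head ras)
  where open Decoded d

dupHead-injective : ∀ {x y} → dupHead x ≡ dupHead y → x ≡ y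
dupHead-injective {[]}    {[]}    _    = refl
dupHead-injective {_ ∷ _} {_ ∷ _} refl = refl

raise-injective : ∀ {x y} → raise x ≡ raise y → x ≡ y
raise-injective {[]}    {[]}    _  = refl
raise-injective {_ ∷ _} {_ ∷ _} eq =
  let h≡ , rest≡ = ∷-injective eq in cong₂ _∷_ (suc-injective h≡) (map-injective suc-injective (∷-injectiveʳ rest≡))

≢-at : ∀ i {x y} → at x i ≢ at y i → x ≢ y
≢-at i at≢ x≡y = at≢ (cong (λ w → at w i) x≡y)

duplicated-second≥2 : ∀ {k} (c : Code k) → 2 ≤ at (decode (duplicated c)) 1
duplicated-second≥2 c with decode c | decode-sound c
... | []    | record { length≡ = () }
... | _ ∷ _ | d = Decoded.2≤head d

raised-second≡1 : ∀ {k} (c : Code k) → at (decode (raised c)) 1 ≡ 1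
raised-second≡1 c with decode c | decode-sound c
... | []    | record { length≡ = () }
... | _ ∷ _ | _ = refl

raised-head≥3 : ∀ {k} (c : Code k) → 3 ≤ at (decode (raised c)) 0
raised-head≥3 c with decode c | decode-sound c
... | []    | record { length≡ = () }
... | _ ∷ _ | d = s≤s (Decoded.2≤head d)

decode-injective : ∀ {k} {c c′ : Code k} → decode c ≡ decode c′ → c ≡ c′
decode-injective {c = duplicated c} {duplicated c′} eq = cong duplicated (decode-injective (dupHead-injective eq))
decode-injective {c = twos o}       {twos o′}       eq = cong twos (twosThenOnes-injective (cong (drop 2) eq))
decode-injective {c = raised c}     {raised c′}     eq = cong raised (decode-injective (raise-injective eq))
decode-injective {c = duplicated c} {twos o′}       eq = ⊥-elim (≢-at 1 (>⇒≢ (duplicated-second≥2 c)) eq)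
decode-injective {c = twos o}       {duplicated c′} eq = ⊥-elim (≢-at 1 (<⇒≢ (duplicated-second≥2 c′)) eq)
decode-injective {c = duplicated c} {raised c′}     eq =
  ⊥-elim (≢-at 1 (λ e → >⇒≢ (duplicated-second≥2 c) (trans e (raised-second≡1 c′))) eq)
decode-injective {c = raised c}     {duplicated c′} eq =
  ⊥-elim (≢-at 1 (λ e → >⇒≢ (duplicated-second≥2 c′) (trans (sym e) (raised-second≡1 c))) eq)
decode-injective {c = twos o}       {raised c′}     eq = ⊥-elim (≢-at 0 (<⇒≢ (raised-head≥3 c′)) eq)
decode-injective {c = raised c}     {twos o′}       eq = ⊥-elim (≢-at 0 (>⇒≢ (raised-head≥3 c)) eq)

codeOf : ∀ k {x} → length x ≡ suc k → 2 ≤ at x 0 → Shape x → ∃[ c ] decode {k} c ≡ x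
codeOf k       _   ()       (ones zero)
codeOf k       _   (s≤s ()) (ones (suc n))
codeOf zero    ()  _        (duplicated _ _)
codeOf (suc k) len _        (duplicated 2≤h ras) =
  let c , ≡x = codeOf k (suc-injective len) 2≤h (shape ras) in duplicated c , cong dupHead ≡x
codeOf k       len _        (twos o) with trans (sym (cong suc (length-twosThenOnes o))) (suc-injective len)
... | refl = twos o , refl
codeOf zero    ()  _        (raised _ _)
codeOf (suc k) len _        (raised {b = b} {t} 2≤h ras) =
  let c , ≡x = codeOf k (trans (cong (ℕ.suc ∘ ℕ.suc) (sym (length-map ℕ.suc t))) (suc-injective len)) 2≤h (shape ras)
  in raised c , cong raise ≡x

decodeᵒ : ∀ {k} → ⊤ ⊎ Code k → Word
decodeᵒ {k} (inj₁ _) = replicate (suc k) 1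
decodeᵒ     (inj₂ c) = decode c

classify : ∀ k {x} → length x ≡ suc k → Ras3231 x → ∃[ m ] decodeᵒ {k} m ≡ x
classify k len ras with shape ras
... | ones n                 = inj₁ tt , cong (λ n → replicate n 1) (trans (sym len) (length-replicate n))
... | s@(duplicated 2≤h _)   = Product.map inj₂ id (codeOf k len 2≤h s)
... | s@(twos _)             = Product.map inj₂ id (codeOf k len ≤-refl s)
... | s@(raised 2≤h _)       = Product.map inj₂ id (codeOf k len (m≤n⇒m≤1+n 2≤h) s)

decodeᵒ-sound : ∀ {k} (m : ⊤ ⊎ Code k) → length (decodeᵒ m) ≡ suc k × All (_≤ suc k) (decodeᵒ m) × Ras3231 (decodeᵒ m)
decodeᵒ-sound {k} (inj₁ _) = length-replicate (suc k) , replicate⁺ (suc k) (s≤s z≤n) , Ras3231-ones k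
decodeᵒ-sound     (inj₂ c) = length≡ , decode-bounded c , ras
  where open Decoded (decode-sound c)

decodeᵒ-injective : ∀ {k} {m m′ : ⊤ ⊎ Code k} → decodeᵒ m ≡ decodeᵒ m′ → m ≡ m′
decodeᵒ-injective {m = inj₁ tt} {inj₁ tt} _  = refl
decodeᵒ-injective {m = inj₂ c}  {inj₂ c′} eq = cong inj₂ (decode-injective eq)
decodeᵒ-injective {m = inj₁ tt} {inj₂ c′} eq = ⊥-elim (≢-at 0 (<⇒≢ (Decoded.2≤head (decode-sound c′))) eq)
decodeᵒ-injective {m = inj₂ c}  {inj₁ tt} eq = ⊥-elim (≢-at 0 (>⇒≢ (Decoded.2≤head (decode-sound c))) eq)

↔-onto-Σ : ∀ {A B : Set} {P : B → Set} → (∀ {b} (p q : P b) → p ≡ q) →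
           (f : A → B) → (∀ {a a′} → f a ≡ f a′ → a ≡ a′) → (∀ a → P (f a)) → (∀ {b} → P b → ∃[ a ] f a ≡ b) →
           A ↔ Σ B P
↔-onto-Σ {P = P} irrelevant f injective sound onto =
  mk↔ₛ′ (λ a → f a , sound a) (λ (_ , p) → proj₁ (onto p)) (λ (_ , p) → Σ-≡ (proj₂ (onto p)))
        (λ a → injective (proj₂ (onto (sound a))))
  where
  Σ-≡ : ∀ {b b′} {p : P b} {p′ : P b′} → b ≡ b′ → (b , p) ≡ (b′ , p′)
  Σ-≡ {b} refl = cong (b ,_) (irrelevant _ _)

Bhat↔ : ∀ k → (⊤ ⊎ Code k) ↔ Bhat (suc k) pattern3231
Bhat↔ k = ↔-onto-Σ T-irrelevant decodeᵒ decodeᵒ-injective (from T-inBhat ∘ decodeᵒ-sound)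
                   (λ p → let len , _ , ras = to T-inBhat p in classify k len ras)

codeCount : ℕ → ℕ
codeCount zero    = 0
codeCount (suc k) = codeCount k + (k + codeCount k)

Fin↔Code : ∀ k → Fin (codeCount k) ↔ Code k
Fin↔Code zero    = mk↔ₛ′ (λ ()) (λ ()) (λ ()) (λ ())
Fin↔Code (suc k) =
  ↔-trans (↔-trans +↔⊎ (↔-refl ⊎-↔ +↔⊎)) (↔-trans (Fin↔Code k ⊎-↔ (↔-refl ⊎-↔ Fin↔Code k)) Code-suc↔)
  where
  Code-suc↔ : (Code k ⊎ (Fin k ⊎ Code k)) ↔ Code (suc k)
  Code-suc↔ = mk↔ₛ′ [ duplicated , [ twos , raised ]′ ]′
    (λ { (duplicated c) → inj₁ c ; (twos o) → inj₂ (inj₁ o) ; (raised c) → inj₂ (inj₂ c) })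
    (λ { (duplicated c) → refl ; (twos o) → refl ; (raised c) → refl })
    (λ { (inj₁ c) → refl ; (inj₂ (inj₁ o)) → refl ; (inj₂ (inj₂ c)) → refl })

codeCount+1+k≡2^k : ∀ k → codeCount k + suc k ≡ 2 ^ k
codeCount+1+k≡2^k zero    = refl
codeCount+1+k≡2^k (suc k) = begin
  (c + (k + c)) + suc (suc k)  ≡⟨ solve 2 (λ c k → (c :+ (k :+ c)) :+ (con 2 :+ k)
                                                  := (c :+ (con 1 :+ k)) :+ (c :+ (con 1 :+ k))) refl c k ⟩
  (c + suc k) + (c + suc k)    ≡⟨ cong₂ _+_ (codeCount+1+k≡2^k k) (trans (codeCount+1+k≡2^k k) (sym (+-identityʳ (2 ^ k)))) ⟩
  2 ^ k + (2 ^ k + 0)          ∎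
  where
  open ≡-Reasoning
  open +-*-Solver
  c : ℕ
  c = codeCount k

mainTheorem7 : (n : ℕ) → 1 ≤ n → Fin (2 ^ (n ∸ 1) ∸ n + 1) ↔ Bhat n pattern3231
mainTheorem7 (suc k) _ = subst (λ N → Fin N ↔ Bhat (suc k) pattern3231) (sym size≡)
                               (↔-trans +↔⊎ (↔-trans (1↔⊤ ⊎-↔ Fin↔Code k) (Bhat↔ k)))
  where
  size≡ : 2 ^ k ∸ suc k + 1 ≡ 1 + codeCount k
  size≡ = begin
    2 ^ k ∸ suc k + 1                   ≡⟨ cong (λ m → m ∸ suc k + 1) (sym (codeCount+1+k≡2^k k)) ⟩
    codeCount k + suc k ∸ suc k + 1     ≡⟨ cong (_+ 1) (m+n∸n≡m (codeCount k) (suc k)) ⟩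
    codeCount k + 1                     ≡⟨ +-comm (codeCount k) 1 ⟩
    1 + codeCount k                     ∎
    where open ≡-Reasoning
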